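{- Let $n$ be even and let $F:\mathbb{F}_2^n\to\mathbb{F}_2^n$ be a quadratic APN function. Then the Boolean function $\varphi_F:\mathbb{F}_2^n\to\mathbb{F}_2$ (defined in the context) has algebraic degree $n$; equivalently, its Hamming weight $|\{a\in\mathbb{F}_2^n:\varphi_F(a)=1\}|$ is odd.
   Context: A vectorial Boolean function $F:\mathbb{F}_2^n\to\mathbb{F}_2^n$ is quadratic if its algebraic normal form has algebraic degree exactly $2$. $F$ is almost perfect nonlinear (APN) if for every $a,b\in\mathbb{F}_2^n$ with $a\neq\mathbf{0}$ the equation $F(x)+F(x+a)=b$ has at most $2$ solutions $x$. For a quadratic APN $F$ and nonzero $a$, the set $B_a(F)=\{F(x)+F(x+a): x\in\mathbb{F}_2^n\}$ is either a linear subspace of dimension $n-1$ or the complement of such a subspace; hence there are a unique nonzero vector $\Phi_F(a)\in\mathbb{F}_2^n$ and a unique bit $\varphi_F(a)\in\mathbb{F}_2$ with $B_a(F)=\{y\in\mathbb{F}_2^n: \Phi_F(a)\cdot y=\varphi_F(a)\}$, where $u\cdot y=\sum_i u_iy_i \bmod 2$. One sets $\Phi_F(\mathbf{0})=\mathbf{0}$ and $\varphi_F(\mathbf{0})=1$. The algebraic degree of a Boolean function is the degree of its algebraic normal form. -}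

module Defs where

open import Data.Bool using (Bool; true; false; _xor_; _∧_; if_then_else_; not)
open import Data.Nat using (ℕ; zero; suc; _⊔_; _+_)
open import Data.List using (List; []; _∷_; [_]; map; _++_; foldr)
open import Data.Nat.ListAction using (sum)
open import Data.Vec using (Vec; []; _∷_; zipWith; lookup; replicate)
open import Data.Fin using (Fin)
open import Data.Product using (Σ; _×_)
open import Relation.Binary.PropositionalEquality using (_≡_; _≢_)

-- Vectors of F₂ⁿ are represented as Vec Bool n (false = 0, true = 1).
V : ℕ → Set
V n = Vec Bool n

𝟎 : ∀ {n} → V n
𝟎 = replicate _ false

_⊕_ : ∀ {n} → V n → V n → V n
_⊕_ = zipWith _xor_

_·_ : ∀ {n} → V n → V n → Bool
[] · [] = false
(u ∷ us) · (y ∷ ys) = (u ∧ y) xor (us · ys)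

_==_ : ∀ {n} → V n → V n → Bool
[] == [] = true
(u ∷ us) == (y ∷ ys) = not (u xor y) ∧ (us == ys)

allVecs : (n : ℕ) → List (V n)
allVecs zero = [ [] ]
allVecs (suc n) = map (false ∷_) (allVecs n) ++ map (true ∷_) (allVecs n)

count : ∀ {n} → (V n → Bool) → ℕ
count {n} p = sum (map (λ x → if p x then 1 else 0) (allVecs n))

wt : ∀ {n} → V n → ℕ
wt [] = 0
wt (b ∷ bs) = (if b then 1 else 0) + wt bs

weight : ∀ {n} → (V n → Bool) → ℕ
weight f = count f

-- x ⪯ u  (support of x contained in support of u)
_⪯_ : ∀ {n} → V n → V n → Bool
[] ⪯ [] = true
(x ∷ xs) ⪯ (u ∷ us) = (not x xor (x ∧ u)) ∧ (xs ⪯ us)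

-- ANF coefficient of the monomial x^u of f:  a_u = ⊕_{x ⪯ u} f(x)
anfCoeff : ∀ {n} → (V n → Bool) → V n → Bool
anfCoeff {n} f u = foldr _xor_ false (map (λ x → (x ⪯ u) ∧ f x) (allVecs n))

-- algebraic degree of a Boolean function: max wt(u) over monomials x^u
-- with nonzero ANF coefficient (0 for the zero function)
deg : ∀ {n} → (V n → Bool) → ℕ
deg {n} f = foldr _⊔_ 0 (map (λ u → if anfCoeff f u then wt u else 0) (allVecs n))

degV : ∀ {n m} → (V n → V m) → ℕ
degV {n} {m} F = foldr _⊔_ 0 (map (λ (i : Fin m) → deg (λ x → lookup (F x) i)) (Data.List.allFin m))
  where import Data.List

Quadratic : ∀ {n} → (V n → V n) → Set
Quadratic F = degV F ≡ 2

APN : ∀ {n} → (V n → V n) → Set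
APN {n} F = ∀ (a : V n) → a ≢ 𝟎 → ∀ (b : V n) →
  count (λ x → (F x ⊕ F (x ⊕ a)) == b) Data.Nat.≤ 2
  where import Data.Nat

-- (Φ, φ) is the pair (Φ_F, φ_F) of a function F: Φ(0) = 0, φ(0) = 1, and for
-- a ≠ 0, Φ(a) ≠ 0 and B_a(F) = {y : Φ(a)·y = φ(a)}.  These conditions
-- determine (Φ_F, φ_F) uniquely (and for quadratic APN F they exist).
IsPhiPair : ∀ {n} → (V n → V n) → (V n → V n) → (V n → Bool) → Set
IsPhiPair {n} F Φ φ =
  (Φ 𝟎 ≡ 𝟎) × (φ 𝟎 ≡ true) ×
  (∀ (a : V n) → a ≢ 𝟎 →
     (Φ a ≢ 𝟎) ×
     (∀ (y : V n) → ((Σ (V n) λ x → F x ⊕ F (x ⊕ a) ≡ y) → Φ a · y ≡ φ a)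
                  × (Φ a · y ≡ φ a → Σ (V n) λ x → F x ⊕ F (x ⊕ a) ≡ y)))

-- Then φ has odd weight, hence algebraic degree n.
-- (Quadraticity of F is what makes such a pair exist; here the pair is given, so
-- the proof only uses APN and the defining property of (Φ, φ).)
--
-- A fixed-point-free involution on a support makes it even, and
--    odd weight forces full degree (the top ANF coefficient is the weight's parity).
--  * Module PhiPair: (i) Φ is linear on its fibres (fibre-linear, by the chain rule
--    for D); (ii) APN makes D_d exactly 2-to-1 onto B_d, so v · D_d is balanced
--    for v ≠ Φ d; (iii) if a were alone in its Φ-fibre, an autocorrelation count
--    for x ↦ Φ a · F x ⊕ w · x would make 2ⁿ⁺¹ a square (module Lonely);
--    (iv) given partners, a ↦ a ⊕ κ(Φ a) pairs off {a ≠ 0 : φ a = 1}, where κ(u) is a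
--    nonzero zero of φ in the fibre u, so weight φ = 1 + even.
--  * For n = 2j + 2, 2ⁿ⁺¹ = 2·4^(j+1) is not a square, which closes the argument.

module Submission where

open import Defs
open import Algebra.Bundles using (CommutativeRing)
open import Data.Bool using (Bool; true; false; _xor_; _∧_; not; if_then_else_)
open import Data.Bool.Properties
  using ( xor-assoc; xor-comm; xor-same; xor-identityʳ; xor-annihilates-not; ∧-distribˡ-xor; ∧-comm
        ; ∧-identityʳ; ∧-zeroʳ; ∧-conicalˡ; ∧-conicalʳ; not-involutive; not-¬; ¬-not
        ; xor-∧-commutativeRing)
  renaming (_≟_ to _≟ᵇ_)
open import Data.Empty using (⊥-elim)
open import Algebra.Properties.CommutativeSemigroup
  (CommutativeRing.+-commutativeSemigroup xor-∧-commutativeRing) using (interchange)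
open import Data.List using (List; []; _∷_; map; foldr; _++_)
open import Data.List.Membership.Propositional using (_∈_; lose)
open import Data.List.Membership.Propositional.Properties using (∈-map⁺; ∈-++⁺ˡ; ∈-++⁺ʳ)
open import Data.List.Properties using (map-++; map-∘; map-cong)
open import Data.List.Relation.Unary.Any using (here; there; any?; satisfied)
open import Data.Nat using (ℕ; zero; suc; _+_; _*_; _^_; _∸_; _≤_; _⊔_; z≤n; s≤s; ≢-nonZero⁻¹)
open import Data.Nat.Divisibility using (_∣_; divides; ∣1⇒≡1)
open import Data.Nat.ListAction using (sum)
open import Data.Nat.ListAction.Properties using (sum-++)
open import Data.Nat.Properties
open import Data.Nat.Tactic.RingSolver using (solve-∀)
open import Data.Product using (Σ; _×_; _,_; proj₁; proj₂)
open import Data.Sum using (_⊎_; inj₁; inj₂)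
open import Data.Vec using ([]; _∷_; replicate)
open import Data.Vec.Properties using (≡-dec)
open import Relation.Nullary using (¬_; Dec; yes; no; ¬?; _×-dec_)
open import Relation.Binary.PropositionalEquality
open ≡-Reasoning

sum-map-cong : ∀ {A : Set} {f g : A → ℕ} → (∀ x → f x ≡ g x) →
  ∀ xs → sum (map f xs) ≡ sum (map g xs)
sum-map-cong f≡g []       = refl
sum-map-cong f≡g (x ∷ xs) = cong₂ _+_ (f≡g x) (sum-map-cong f≡g xs)

sum-map-+ : ∀ {A : Set} (f g : A → ℕ) xs →
  sum (map (λ x → f x + g x) xs) ≡ sum (map f xs) + sum (map g xs)
sum-map-+ f g []       = refl
sum-map-+ f g (x ∷ xs) = begin
  f x + g x + sum (map (λ x → f x + g x) xs)   ≡⟨ cong (f x + g x +_) (sum-map-+ f g xs) ⟩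
  f x + g x + (sum (map f xs) + sum (map g xs)) ≡⟨ +-+-interchange (f x) (g x) _ _ ⟩
  f x + sum (map f xs) + (g x + sum (map g xs)) ∎
  where
  +-+-interchange : ∀ a b c d → a + b + (c + d) ≡ a + c + (b + d)
  +-+-interchange = solve-∀

sum-map-*ˡ : ∀ {A : Set} (k : ℕ) (f : A → ℕ) xs →
  sum (map (λ x → k * f x) xs) ≡ k * sum (map f xs)
sum-map-*ˡ k f []       = sym (*-zeroʳ k)
sum-map-*ˡ k f (x ∷ xs) =
  trans (cong (k * f x +_) (sum-map-*ˡ k f xs)) (sym (*-distribˡ-+ k (f x) _))

sum-map-0 : ∀ {A : Set} (xs : List A) → sum (map (λ _ → 0) xs) ≡ 0
sum-map-0 []       = refl
sum-map-0 (x ∷ xs) = sum-map-0 xs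

sum-map-swap : ∀ {A B : Set} (g : A → B → ℕ) xs ys →
  sum (map (λ x → sum (map (g x) ys)) xs) ≡ sum (map (λ y → sum (map (λ x → g x y) xs)) ys)
sum-map-swap g []       ys = sym (sum-map-0 ys)
sum-map-swap g (x ∷ xs) ys =
  trans (cong (sum (map (g x) ys) +_) (sum-map-swap g xs ys))
        (sym (sum-map-+ (g x) (λ y → sum (map (λ x → g x y) xs)) ys))

sum-map-mono : ∀ {A : Set} {f g : A → ℕ} → (∀ x → f x ≤ g x) →
  ∀ xs → sum (map f xs) ≤ sum (map g xs)
sum-map-mono f≤g []       = z≤n
sum-map-mono f≤g (x ∷ xs) = +-mono-≤ (f≤g x) (sum-map-mono f≤g xs)

-- Summation over the whole space F₂ⁿ.  Note that `count p` from Defs is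
-- definitionally `∑ n (λ x → ind (p x))`.

∑ : (n : ℕ) → (V n → ℕ) → ℕ
∑ n f = sum (map f (allVecs n))

ind : Bool → ℕ
ind b = if b then 1 else 0

∑-cong : ∀ n {f g : V n → ℕ} → (∀ x → f x ≡ g x) → ∑ n f ≡ ∑ n g
∑-cong n f≡g = sum-map-cong f≡g (allVecs n)

∑-+ : ∀ n (f g : V n → ℕ) → ∑ n (λ x → f x + g x) ≡ ∑ n f + ∑ n g
∑-+ n f g = sum-map-+ f g (allVecs n)

∑-*ˡ : ∀ n k (f : V n → ℕ) → ∑ n (λ x → k * f x) ≡ k * ∑ n f
∑-*ˡ n k f = sum-map-*ˡ k f (allVecs n)

∑-swap : ∀ n m (g : V n → V m → ℕ) → ∑ n (λ x → ∑ m (g x)) ≡ ∑ m (λ y → ∑ n (λ x → g x y))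
∑-swap n m g = sum-map-swap g (allVecs n) (allVecs m)

∑-mono : ∀ n {f g : V n → ℕ} → (∀ x → f x ≤ g x) → ∑ n f ≤ ∑ n g
∑-mono n f≤g = sum-map-mono f≤g (allVecs n)

∑-suc : ∀ n (f : V (suc n) → ℕ) → ∑ (suc n) f ≡ ∑ n (λ x → f (false ∷ x)) + ∑ n (λ x → f (true ∷ x))
∑-suc n f = begin
  sum (map f (map (false ∷_) xs ++ map (true ∷_) xs))
    ≡⟨ cong sum (map-++ f (map (false ∷_) xs) (map (true ∷_) xs)) ⟩
  sum (map f (map (false ∷_) xs) ++ map f (map (true ∷_) xs))
    ≡⟨ sum-++ (map f (map (false ∷_) xs)) _ ⟩
  sum (map f (map (false ∷_) xs)) + sum (map f (map (true ∷_) xs))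
    ≡⟨ cong₂ (λ l r → sum l + sum r) (sym (map-∘ xs)) (sym (map-∘ xs)) ⟩
  ∑ n (λ x → f (false ∷ x)) + ∑ n (λ x → f (true ∷ x)) ∎
  where
  xs = allVecs n

∑-const : ∀ n k → ∑ n (λ _ → k) ≡ 2 ^ n * k
∑-const zero    k = trans (+-identityʳ k) (sym (+-identityʳ k))
∑-const (suc n) k = begin
  ∑ (suc n) (λ _ → k)                ≡⟨ ∑-suc n (λ _ → k) ⟩
  ∑ n (λ _ → k) + ∑ n (λ _ → k)     ≡⟨ cong₂ _+_ (∑-const n k) (∑-const n k) ⟩
  2 ^ n * k + 2 ^ n * k             ≡⟨ double (2 ^ n) k ⟩
  2 ^ suc n * k                     ∎
  where
  double : ∀ p k → p * k + p * k ≡ 2 * p * k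
  double = solve-∀

count-true : ∀ n (p : V n → Bool) → (∀ x → p x ≡ true) → count p ≡ 2 ^ n
count-true n p always = trans (∑-cong n (λ x → cong ind (always x))) (trans (∑-const n 1) (*-identityʳ _))

⊕-comm : ∀ {n} (x y : V n) → x ⊕ y ≡ y ⊕ x
⊕-comm []       []       = refl
⊕-comm (a ∷ x) (b ∷ y) = cong₂ _∷_ (xor-comm a b) (⊕-comm x y)

⊕-assoc : ∀ {n} (x y z : V n) → (x ⊕ y) ⊕ z ≡ x ⊕ (y ⊕ z)
⊕-assoc []       []       []       = refl
⊕-assoc (a ∷ x) (b ∷ y) (c ∷ z) = cong₂ _∷_ (xor-assoc a b c) (⊕-assoc x y z)

⊕-identityˡ : ∀ {n} (x : V n) → 𝟎 ⊕ x ≡ x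
⊕-identityˡ []       = refl
⊕-identityˡ (a ∷ x) = cong (a ∷_) (⊕-identityˡ x)

⊕-identityʳ : ∀ {n} (x : V n) → x ⊕ 𝟎 ≡ x
⊕-identityʳ x = trans (⊕-comm x 𝟎) (⊕-identityˡ x)

⊕-self : ∀ {n} (x : V n) → x ⊕ x ≡ 𝟎
⊕-self []       = refl
⊕-self (a ∷ x) = cong₂ _∷_ (xor-same a) (⊕-self x)

⊕-cancelʳ : ∀ {n} (x a : V n) → (x ⊕ a) ⊕ a ≡ x
⊕-cancelʳ x a = begin
  (x ⊕ a) ⊕ a ≡⟨ ⊕-assoc x a a ⟩
  x ⊕ (a ⊕ a) ≡⟨ cong (x ⊕_) (⊕-self a) ⟩
  x ⊕ 𝟎       ≡⟨ ⊕-identityʳ x ⟩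
  x           ∎

⊕-cancelˡ : ∀ {n} (a x : V n) → a ⊕ (a ⊕ x) ≡ x
⊕-cancelˡ a x = begin
  a ⊕ (a ⊕ x) ≡⟨ sym (⊕-assoc a a x) ⟩
  (a ⊕ a) ⊕ x ≡⟨ cong (_⊕ x) (⊕-self a) ⟩
  𝟎 ⊕ x       ≡⟨ ⊕-identityˡ x ⟩
  x           ∎

⊕-≡𝟎 : ∀ {n} (x y : V n) → x ⊕ y ≡ 𝟎 → x ≡ y
⊕-≡𝟎 x y e = begin
  x           ≡⟨ sym (⊕-cancelʳ x y) ⟩
  (x ⊕ y) ⊕ y ≡⟨ cong (_⊕ y) e ⟩
  𝟎 ⊕ y       ≡⟨ ⊕-identityˡ y ⟩
  y           ∎

⊕-fix : ∀ {n} (x a : V n) → x ⊕ a ≡ x → a ≡ 𝟎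
⊕-fix x a e = trans (sym (⊕-cancelˡ x a)) (trans (cong (x ⊕_) e) (⊕-self x))

dot-⊕ʳ : ∀ {n} (v x y : V n) → v · (x ⊕ y) ≡ (v · x) xor (v · y)
dot-⊕ʳ []       []       []       = refl
dot-⊕ʳ (a ∷ v) (b ∷ x) (c ∷ y) = trans (cong₂ _xor_ (∧-distribˡ-xor a b c) (dot-⊕ʳ v x y))
  (interchange (a ∧ b) (a ∧ c) (v · x) (v · y))

dot-comm : ∀ {n} (u v : V n) → u · v ≡ v · u
dot-comm []       []       = refl
dot-comm (a ∷ u) (b ∷ v) = cong₂ _xor_ (∧-comm a b) (dot-comm u v)

dot-⊕ˡ : ∀ {n} (u v y : V n) → (u ⊕ v) · y ≡ (u · y) xor (v · y)
dot-⊕ˡ u v y = trans (dot-comm (u ⊕ v) y) (trans (dot-⊕ʳ y u v) (cong₂ _xor_ (dot-comm y u) (dot-comm y v)))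

dot-𝟎ˡ : ∀ {n} (y : V n) → 𝟎 · y ≡ false
dot-𝟎ˡ []       = refl
dot-𝟎ˡ (b ∷ y) = dot-𝟎ˡ y

solve-dot : ∀ {n} (a : V n) → a ≢ 𝟎 → ∀ t → Σ (V n) (λ w → w · a ≡ t)
solve-dot []          a≢𝟎 t = ⊥-elim (a≢𝟎 refl)
solve-dot (true ∷ a)  _   t =
  (t ∷ 𝟎) , trans (cong ((t ∧ true) xor_) (dot-𝟎ˡ a)) (trans (xor-identityʳ _) (∧-identityʳ t))
solve-dot (false ∷ a) a≢𝟎 t with solve-dot a (λ a≡𝟎 → a≢𝟎 (cong (false ∷_) a≡𝟎)) t
... | w , w·a≡t = (false ∷ w) , w·a≡t

==-refl : ∀ {n} (x : V n) → (x == x) ≡ true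
==-refl []          = refl
==-refl (false ∷ x) = ==-refl x
==-refl (true ∷ x)  = ==-refl x

==-complete : ∀ {n} {x y : V n} → x ≡ y → (x == y) ≡ true
==-complete {x = x} refl = ==-refl x

==-sound : ∀ {n} (x y : V n) → (x == y) ≡ true → x ≡ y
==-sound []          []          _ = refl
==-sound (false ∷ x) (false ∷ y) e = cong (false ∷_) (==-sound x y e)
==-sound (true ∷ x)  (true ∷ y)  e = cong (true ∷_) (==-sound x y e)
==-sound (false ∷ x) (true ∷ y)  ()
==-sound (true ∷ x)  (false ∷ y) ()

==-false : ∀ {n} (x y : V n) → x ≢ y → (x == y) ≡ false
==-false x y x≢y = ¬-not (λ e → x≢y (==-sound x y e))

==-false⇒≢ : ∀ {n} {x y : V n} → (x == y) ≡ false → x ≢ y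
==-false⇒≢ test x≡y = not-¬ (==-complete x≡y) test

==-sym : ∀ {n} (x y : V n) → (x == y) ≡ (y == x)
==-sym []       []       = refl
==-sym (a ∷ x) (b ∷ y) = cong₂ (λ c d → not c ∧ d) (xor-comm a b) (==-sym x y)

_≟ᵥ_ : ∀ {n} (x y : V n) → Dec (x ≡ y)
_≟ᵥ_ = ≡-dec _≟ᵇ_

true≢false : true ≢ false
true≢false ()

infix 7 _≐_
_≐_ : Bool → Bool → Bool
b ≐ c = not (b xor c)

≐-sound : ∀ b c → (b ≐ c) ≡ true → b ≡ c
≐-sound false false _ = refl
≐-sound true  true  _ = refl

≐-complete : ∀ {b c} → b ≡ c → (b ≐ c) ≡ true
≐-complete {false} refl = refl
≐-complete {true}  refl = refl

≐-≢ : ∀ {b c} → b ≢ c → (b ≐ c) ≡ false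
≐-≢ {false} {false} b≢c = ⊥-elim (b≢c refl)
≐-≢ {false} {true}  _   = refl
≐-≢ {true}  {false} _   = refl
≐-≢ {true}  {true}  b≢c = ⊥-elim (b≢c refl)

≐-not : ∀ b c → (b ≐ not c) ≡ not (b ≐ c)
≐-not false c = refl
≐-not true  c = refl

∑-δ : ∀ n (y : V n) (h : V n → ℕ) → ∑ n (λ x → if x == y then h x else 0) ≡ h y
∑-δ zero    []          h = +-identityʳ (h [])
∑-δ (suc n) (false ∷ y) h = begin
  ∑ (suc n) (λ x → if x == (false ∷ y) then h x else 0)
    ≡⟨ ∑-suc n _ ⟩
  ∑ n (λ x → if x == y then h (false ∷ x) else 0) + ∑ n (λ _ → 0)
    ≡⟨ cong₂ _+_ (∑-δ n y (λ x → h (false ∷ x))) (sum-map-0 (allVecs n)) ⟩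
  h (false ∷ y) + 0
    ≡⟨ +-identityʳ _ ⟩
  h (false ∷ y) ∎
∑-δ (suc n) (true ∷ y)  h = begin
  ∑ (suc n) (λ x → if x == (true ∷ y) then h x else 0)
    ≡⟨ ∑-suc n _ ⟩
  ∑ n (λ _ → 0) + ∑ n (λ x → if x == y then h (true ∷ x) else 0)
    ≡⟨ cong₂ _+_ (sum-map-0 (allVecs n)) (∑-δ n y (λ x → h (true ∷ x))) ⟩
  h (true ∷ y) ∎

∑-fibres : ∀ n k (f : V n → V k) (h : V k → ℕ) →
  ∑ n (λ x → h (f x)) ≡ ∑ k (λ y → h y * count (λ x → f x == y))
∑-fibres n k f h = begin
  ∑ n (λ x → h (f x))
    ≡⟨ ∑-cong n (λ x → sym (∑-δ k (f x) h)) ⟩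
  ∑ n (λ x → ∑ k (λ y → if y == f x then h y else 0))
    ≡⟨ ∑-swap n k _ ⟩
  ∑ k (λ y → ∑ n (λ x → if y == f x then h y else 0))
    ≡⟨ ∑-cong k (λ y → trans (∑-cong n (select y)) (∑-*ˡ n (h y) _)) ⟩
  ∑ k (λ y → h y * count (λ x → f x == y)) ∎
  where
  select : ∀ y x → (if y == f x then h y else 0) ≡ h y * ind (f x == y)
  select y x rewrite ==-sym y (f x) with f x == y
  ... | true  = sym (*-identityʳ (h y))
  ... | false = sym (*-zeroʳ (h y))

-- Reindexing a sum along an involution of F₂ⁿ (in particular a translation):
-- every y has the single preimage ι y.
∑-involution : ∀ n (ι : V n → V n) → (∀ x → ι (ι x) ≡ x) →
  (h : V n → ℕ) → ∑ n (λ x → h (ι x)) ≡ ∑ n h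
∑-involution n ι ι∘ι h = begin
  ∑ n (λ x → h (ι x))                        ≡⟨ ∑-fibres n n ι h ⟩
  ∑ n (λ y → h y * count (λ x → ι x == y))   ≡⟨ ∑-cong n (λ y → cong (h y *_) (unique-preimage y)) ⟩
  ∑ n (λ y → h y * 1)                        ≡⟨ ∑-cong n (λ y → *-identityʳ (h y)) ⟩
  ∑ n h                                      ∎
  where
  flip : ∀ x y → ι x ≡ y → x ≡ ι y
  flip x _ refl = sym (ι∘ι x)
  flip-test : ∀ x y → (ι x == y) ≡ (x == ι y)
  flip-test x y with ι x == y in e₁ | x == ι y in e₂
  ... | true  | true  = refl
  ... | false | false = refl
  ... | true  | false = trans (sym (==-complete (flip x y (==-sound (ι x) y e₁)))) e₂
  ... | false | true  = trans (sym e₁) (==-complete (trans (cong ι (==-sound x (ι y) e₂)) (ι∘ι y)))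
  unique-preimage : ∀ y → count (λ x → ι x == y) ≡ 1
  unique-preimage y = trans (∑-cong n (λ x → cong ind (flip-test x y))) (∑-δ n (ι y) (λ _ → 1))

∑-translate : ∀ n (a : V n) (h : V n → ℕ) → ∑ n (λ x → h (x ⊕ a)) ≡ ∑ n h
∑-translate n a = ∑-involution n (_⊕ a) (λ x → ⊕-cancelʳ x a)

allVecs-complete : ∀ {n} (x : V n) → x ∈ allVecs n
allVecs-complete []                  = here refl
allVecs-complete {suc n} (false ∷ x) = ∈-++⁺ˡ (∈-map⁺ (false ∷_) (allVecs-complete x))
allVecs-complete {suc n} (true ∷ x)  =
  ∈-++⁺ʳ (map (false ∷_) (allVecs n)) (∈-map⁺ (true ∷_) (allVecs-complete x))

search : ∀ {n} {P : V n → Set} → (∀ x → Dec (P x)) → Σ (V n) P ⊎ (∀ x → ¬ P x)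
search {n} P? with any? P? (allVecs n)
... | yes found = inj₁ (satisfied found)
... | no  none  = inj₂ (λ x Px → none (lose (allVecs-complete x) Px))

pick : ∀ {n} {P : V n → Set} → (∀ x → Dec (P x)) → V n
pick P? with search P?
... | inj₁ (x , _) = x
... | inj₂ _       = 𝟎

pick-sound : ∀ {n} {P : V n → Set} (P? : ∀ x → Dec (P x)) → Σ (V n) P → P (pick P?)
pick-sound P? (x , Px) with search P?
... | inj₁ (_ , Py) = Py
... | inj₂ none     = ⊥-elim (none x Px)

count≢0⇒witness : ∀ {n} (q : V n → Bool) → count q ≢ 0 → Σ (V n) (λ x → q x ≡ true)
count≢0⇒witness {n} q count≢0 with search (λ x → q x ≟ᵇ true)
... | inj₁ found = found
... | inj₂ none  = ⊥-elim (count≢0 (trans (∑-cong n (λ x → cong ind (¬-not (none x)))) (sum-map-0 (allVecs n))))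

two-witnesses : ∀ {n} (q : V n → Bool) x₀ x₁ → q x₀ ≡ true → q x₁ ≡ true → x₀ ≢ x₁ → 2 ≤ count q
two-witnesses {n} q x₀ x₁ q₀ q₁ x₀≢x₁ = subst (_≤ count q) two (∑-mono n pointwise)
  where
  two : ∑ n (λ x → ind (x == x₀) + ind (x == x₁)) ≡ 2
  two = trans (∑-+ n _ _) (cong₂ _+_ (∑-δ n x₀ (λ _ → 1)) (∑-δ n x₁ (λ _ → 1)))
  hit : ∀ {x y} → (x == y) ≡ true → q y ≡ true → 1 ≤ ind (q x)
  hit {x} {y} e qy rewrite ==-sound x y e | qy = s≤s z≤n
  pointwise : ∀ x → ind (x == x₀) + ind (x == x₁) ≤ ind (q x)
  pointwise x with x == x₀ in e₀ | x == x₁ in e₁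
  ... | true  | true  = ⊥-elim (x₀≢x₁ (trans (sym (==-sound x x₀ e₀)) (==-sound x x₁ e₁)))
  ... | true  | false = hit e₀ q₀
  ... | false | true  = hit e₁ q₁
  ... | false | false = z≤n

count-split : ∀ {n} (p q : V n → Bool) →
  count p ≡ count (λ x → p x ∧ q x) + count (λ x → p x ∧ not (q x))
count-split {n} p q = trans (∑-cong n pointwise) (∑-+ n _ _)
  where
  pointwise : ∀ x → ind (p x) ≡ ind (p x ∧ q x) + ind (p x ∧ not (q x))
  pointwise x with p x | q x
  ... | false | _     = refl
  ... | true  | true  = refl
  ... | true  | false = refl

half : ∀ m a → a + a ≡ 2 ^ suc m → a ≡ 2 ^ m
half m a a+a≡2^m⁺ = *-cancelˡ-≡ a (2 ^ m) 2 (trans (cong (a +_) (+-identityʳ a)) a+a≡2^m⁺)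

-- An affine hyperplane {y : u · y = c} of F₂^(m+1), u ≠ 0, has 2^m points:
-- translating by some t with u · t = 1 exchanges it with its complement.
hyperplane-size : ∀ m (u : V (suc m)) → u ≢ 𝟎 → ∀ c → count (λ y → u · y ≐ c) ≡ 2 ^ m
hyperplane-size m u u≢𝟎 c = half m (H c) (begin
  H c + H c                               ≡⟨ cong (H c +_) complement≡ ⟩
  H c + count (λ y → not (u · y ≐ c))     ≡⟨ sym (count-split (λ _ → true) (λ y → u · y ≐ c)) ⟩
  ∑ (suc m) (λ _ → 1)                     ≡⟨ ∑-const (suc m) 1 ⟩
  2 ^ suc m * 1                           ≡⟨ *-identityʳ _ ⟩
  2 ^ suc m                               ∎)
  where
  H : Bool → ℕ
  H c = count (λ y → u · y ≐ c)
  t = proj₁ (solve-dot u u≢𝟎 true)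
  u·t≡1 : u · t ≡ true
  u·t≡1 = trans (dot-comm u t) (proj₂ (solve-dot u u≢𝟎 true))
  shift : ∀ b c → (b xor true) ≐ c ≡ not (b ≐ c)
  shift false false = refl
  shift false true  = refl
  shift true  false = refl
  shift true  true  = refl
  complement≡ : H c ≡ count (λ y → not (u · y ≐ c))
  complement≡ = begin
    H c                                       ≡⟨ sym (∑-translate (suc m) t (λ y → ind (u · y ≐ c))) ⟩
    ∑ (suc m) (λ y → ind (u · (y ⊕ t) ≐ c))  ≡⟨ ∑-cong (suc m) (λ y → cong (λ b → ind (b ≐ c)) (dot-⊕ʳ u y t)) ⟩
    ∑ (suc m) (λ y → ind (((u · y) xor (u · t)) ≐ c))
      ≡⟨ ∑-cong (suc m) (λ y → cong ind (trans (cong (λ b → ((u · y) xor b) ≐ c) u·t≡1) (shift (u · y) c))) ⟩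
    count (λ y → not (u · y ≐ c))             ∎

meet : ∀ {n} → V n → V n → Bool → Bool → ℕ
meet u v c e = count (λ y → (u · y ≐ c) ∧ (v · y ≐ e))

meet-comm : ∀ {n} (u v : V n) c e → meet u v c e ≡ meet v u e c
meet-comm {n} u v c e = ∑-cong n (λ y → cong ind (∧-comm (u · y ≐ c) (v · y ≐ e)))

meet-split : ∀ m (u v : V (suc m)) → u ≢ 𝟎 → ∀ c e → meet u v c e + meet u v c (not e) ≡ 2 ^ m
meet-split m u v u≢𝟎 c e = begin
  meet u v c e + meet u v c (not e)
    ≡⟨ cong (meet u v c e +_) (∑-cong (suc m) (λ y → cong (λ b → ind ((u · y ≐ c) ∧ b)) (≐-not (v · y) e))) ⟩
  count (λ y → (u · y ≐ c) ∧ (v · y ≐ e)) + count (λ y → (u · y ≐ c) ∧ not (v · y ≐ e))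
    ≡⟨ sym (count-split (λ y → u · y ≐ c) (λ y → v · y ≐ e)) ⟩
  count (λ y → u · y ≐ c)
    ≡⟨ hyperplane-size m u u≢𝟎 c ⟩
  2 ^ m ∎

meet-⊕ : ∀ {n} (u v : V n) c e → meet (u ⊕ v) u (c xor e) c ≡ meet u v c e
meet-⊕ {n} u v c e = ∑-cong n (λ y → cong ind (trans
  (cong (λ b → (b ≐ (c xor e)) ∧ (u · y ≐ c)) (dot-⊕ˡ u v y)) (same-condition (u · y) (v · y) c e)))
  where
  same-condition : ∀ p q c e → ((p xor q) ≐ (c xor e)) ∧ (p ≐ c) ≡ (p ≐ c) ∧ (q ≐ e)
  same-condition false q false e = ∧-identityʳ _
  same-condition false q true  e = ∧-zeroʳ _
  same-condition true  q false e = ∧-zeroʳ _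
  same-condition true  q true  e = trans (∧-identityʳ _) (cong not (xor-annihilates-not q e))

-- With N₁ = meet c e, N₂ = meet c ¬e, N₃ = meet ¬c ¬e, splitting the hyperplanes of
-- u, v and u ⊕ v gives N₁ + N₂ = N₂ + N₃ = N₁ + N₃ = 2^(m+1).
meet-size : ∀ m (u v : V (suc (suc m))) → u ≢ 𝟎 → v ≢ 𝟎 → u ≢ v → ∀ c e →
  meet u v c e ≡ 2 ^ m
meet-size m u v u≢𝟎 v≢𝟎 u≢v c e = half m N₁ (trans (cong (N₁ +_) N₁≡N₃) N₁+N₃)
  where
  N₁ = meet u v c e
  N₂ = meet u v c (not e)
  N₃ = meet u v (not c) (not e)
  N₁+N₂ : N₁ + N₂ ≡ 2 ^ suc m
  N₁+N₂ = meet-split (suc m) u v u≢𝟎 c e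
  N₂+N₃ : N₂ + N₃ ≡ 2 ^ suc m
  N₂+N₃ = trans (cong₂ _+_ (meet-comm u v c (not e)) (meet-comm u v (not c) (not e)))
                (meet-split (suc m) v u v≢𝟎 (not e) c)
  N₁+N₃ : N₁ + N₃ ≡ 2 ^ suc m
  N₁+N₃ = begin
    N₁ + N₃
      ≡⟨ cong₂ _+_ (sym (meet-⊕ u v c e)) (sym (meet-⊕ u v (not c) (not e))) ⟩
    meet (u ⊕ v) u (c xor e) c + meet (u ⊕ v) u (not c xor not e) (not c)
      ≡⟨ cong (λ b → meet (u ⊕ v) u (c xor e) c + meet (u ⊕ v) u b (not c)) (xor-annihilates-not c e) ⟩
    meet (u ⊕ v) u (c xor e) c + meet (u ⊕ v) u (c xor e) (not c)
      ≡⟨ meet-split (suc m) (u ⊕ v) u (λ z → u≢v (⊕-≡𝟎 u v z)) (c xor e) c ⟩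
    2 ^ suc m ∎
  N₁≡N₃ : N₁ ≡ N₃
  N₁≡N₃ = +-cancelˡ-≡ N₂ N₁ N₃ (trans (+-comm N₂ N₁) (trans N₁+N₂ (sym N₂+N₃)))

hyperplane-normal : ∀ m (u v : V (suc (suc m))) c e → u ≢ 𝟎 → v ≢ 𝟎 →
  (∀ y → u · y ≡ c → v · y ≡ e) → u ≡ v
hyperplane-normal m u v c e u≢𝟎 v≢𝟎 incl with u ≟ᵥ v
... | yes u≡v = u≡v
... | no  u≢v = ⊥-elim (not-¬ (incl y (≐-sound _ _ on-u)) (≐-sound _ _ on-v))
  where
  nonempty : meet u v c (not e) ≢ 0
  nonempty z = ≢-nonZero⁻¹ (2 ^ m) {{m^n≢0 2 m}} (trans (sym (meet-size m u v u≢𝟎 v≢𝟎 u≢v c (not e))) z)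
  witness = count≢0⇒witness (λ y → (u · y ≐ c) ∧ (v · y ≐ not e)) nonempty
  y = proj₁ witness
  on-u : (u · y ≐ c) ≡ true
  on-u = ∧-conicalˡ _ _ (proj₂ witness)
  on-v : (v · y ≐ not e) ≡ true
  on-v = ∧-conicalʳ _ _ (proj₂ witness)

-- Elementary arithmetic: 2·4^k is not a perfect square.  This is where the
-- parity of n enters the proof.

odd≢even : ∀ a b → suc (a + a) ≢ b + b
odd≢even a       zero    ()
odd≢even zero    (suc b) e = 0≢1+n (trans (suc-injective e) (+-suc b b))
odd≢even (suc a) (suc b) e =
  odd≢even a b (suc-injective (trans (cong suc (sym (+-suc a a))) (trans (suc-injective e) (+-suc b b))))

parity : ∀ t → Σ ℕ (λ s → (t ≡ s + s) ⊎ (t ≡ suc (s + s)))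
parity zero    = 0 , inj₁ refl
parity (suc t) with parity t
... | s , inj₁ t≡s+s  = s , inj₂ (cong suc t≡s+s)
... | s , inj₂ t≡1+2s = suc s , inj₁ (trans (cong suc t≡1+2s) (cong suc (sym (+-suc s s))))

four-times : ∀ k → 2 * 2 ^ (suc k + suc k) ≡ 4 * (2 * 2 ^ (k + k))
four-times k = begin
  2 * 2 ^ (suc k + suc k)     ≡⟨ cong (λ z → 2 * 2 ^ suc z) (+-suc k k) ⟩
  2 * (2 * (2 * 2 ^ (k + k))) ≡⟨ regroup (2 ^ (k + k)) ⟩
  4 * (2 * 2 ^ (k + k))       ∎
  where
  regroup : ∀ p → 2 * (2 * (2 * p)) ≡ 4 * (2 * p)
  regroup = solve-∀

-- An odd square is odd; an even square (2s)² = 4s² reduces k by one.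
not-square : ∀ k t → t * t ≢ 2 * 2 ^ (k + k)
not-square zero    0             ()
not-square zero    1             ()
not-square zero    (suc (suc r)) e = four+x≢2 (trans (sym (expand r)) e)
  where
  expand : ∀ r → suc (suc r) * suc (suc r) ≡ 4 + (4 * r + r * r)
  expand = solve-∀
  four+x≢2 : ∀ {x} → 4 + x ≢ 2
  four+x≢2 ()
not-square (suc k) t e with parity t
... | s , inj₂ refl = odd≢even (2 * s + 2 * (s * s)) R
        (trans (sym (odd-square s)) (trans e (cong (R +_) (+-identityʳ R))))
  where
  R = 2 ^ (suc k + suc k)
  odd-square : ∀ s → suc (s + s) * suc (s + s) ≡ suc ((2 * s + 2 * (s * s)) + (2 * s + 2 * (s * s)))
  odd-square = solve-∀
... | s , inj₁ refl = not-square k s (*-cancelˡ-≡ (s * s) (2 * 2 ^ (k + k)) 4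
        (trans (sym (even-square s)) (trans e (four-times k))))
  where
  even-square : ∀ s → (s + s) * (s + s) ≡ 4 * (s * s)
  even-square = solve-∀

-- If (B + t) + B = 2X and (B + t)² + B² = 2(X² + X) then t² = 4X, because
-- (A − B)² = 2(A² + B²) − (A + B)² for A = B + t.
difference-square : ∀ B t X → (B + t) + B ≡ 2 * X →
  (B + t) * (B + t) + B * B ≡ 2 * (X * X + X) → t * t ≡ 4 * X
difference-square B t X sum sumsq = +-cancelˡ-≡ ((2 * X) * (2 * X)) (t * t) (4 * X) (begin
  (2 * X) * (2 * X) + t * t           ≡⟨ cong (λ z → z * z + t * t) (sym sum) ⟩
  (B + t + B) * (B + t + B) + t * t   ≡⟨ parallelogram B t ⟩
  2 * ((B + t) * (B + t) + B * B)     ≡⟨ cong (2 *_) sumsq ⟩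
  2 * (2 * (X * X + X))               ≡⟨ expand X ⟩
  (2 * X) * (2 * X) + 4 * X           ∎)
  where
  parallelogram : ∀ B t → (B + t + B) * (B + t + B) + t * t ≡ 2 * ((B + t) * (B + t) + B * B)
  parallelogram = solve-∀
  expand : ∀ X → 2 * (2 * (X * X + X)) ≡ (2 * X) * (2 * X) + 4 * X
  expand = solve-∀

ordered-gap : ∀ A B X → B ≤ A → A + B ≡ 2 * X → A * A + B * B ≡ 2 * (X * X + X) →
  (A ∸ B) * (A ∸ B) ≡ 4 * X
ordered-gap A B X B≤A sum sumsq = difference-square B (A ∸ B) X
  (subst (λ a → a + B ≡ 2 * X) A≡B+t sum) (subst (λ a → a * a + B * B ≡ 2 * (X * X + X)) A≡B+t sumsq)
  where A≡B+t = sym (m+[n∸m]≡n B≤A)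

square-gap : ∀ A B X → A + B ≡ 2 * X → A * A + B * B ≡ 2 * (X * X + X) → Σ ℕ (λ t → t * t ≡ 4 * X)
square-gap A B X sum sumsq with ≤-total B A
... | inj₁ B≤A = A ∸ B , ordered-gap A B X B≤A sum sumsq
... | inj₂ A≤B = B ∸ A , ordered-gap B A X A≤B (trans (+-comm B A) sum) (trans (+-comm (B * B) (A * A)) sumsq)

-- Strict lexicographic order on F₂ⁿ (false < true); used only to pick one
-- element from each orbit {x, ι x}.
_<ˡ_ : ∀ {n} → V n → V n → Bool
[]      <ˡ []      = false
(a ∷ x) <ˡ (b ∷ y) = if a xor b then b else x <ˡ y

<ˡ-exactly-one : ∀ {n} (x y : V n) → x ≢ y → ind (x <ˡ y) + ind (y <ˡ x) ≡ 1
<ˡ-exactly-one []          []          x≢y = ⊥-elim (x≢y refl)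
<ˡ-exactly-one (false ∷ x) (false ∷ y) x≢y = <ˡ-exactly-one x y (λ e → x≢y (cong (false ∷_) e))
<ˡ-exactly-one (true ∷ x)  (true ∷ y)  x≢y = <ˡ-exactly-one x y (λ e → x≢y (cong (true ∷_) e))
<ˡ-exactly-one (false ∷ x) (true ∷ y)  _   = refl
<ˡ-exactly-one (true ∷ x)  (false ∷ y) _   = refl

-- If an involution ι preserves T and has no fixed point where T holds, then
-- T holds on an even number of points: count T = 2 · #{x : T x, x <ˡ ι x}.
involution-even : ∀ n (T : V n → Bool) (ι : V n → V n) → (∀ x → ι (ι x) ≡ x) →
  (∀ x → T (ι x) ≡ T x) → (∀ x → T x ≡ true → ι x ≢ x) → Σ ℕ (λ s → count T ≡ s + s)
involution-even n T ι ι∘ι T∘ι no-fix = ∑ n h , (begin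
  count T                       ≡⟨ ∑-cong n orbit ⟩
  ∑ n (λ x → h x + h (ι x))     ≡⟨ ∑-+ n h (λ x → h (ι x)) ⟩
  ∑ n h + ∑ n (λ x → h (ι x))   ≡⟨ cong (∑ n h +_) (∑-involution n ι ι∘ι h) ⟩
  ∑ n h + ∑ n h                 ∎)
  where
  h : V n → ℕ
  h x = ind (T x ∧ (x <ˡ ι x))
  orbit : ∀ x → ind (T x) ≡ h x + h (ι x)
  orbit x rewrite ι∘ι x | T∘ι x with T x in Tx
  ... | true  = sym (<ˡ-exactly-one x (ι x) (λ e → no-fix x Tx (sym e)))
  ... | false = refl

-- A Boolean function of odd weight has full algebraic degree: the ANF
-- coefficient of the top monomial x₁⋯xₙ is the parity of the weight.

odd? : ℕ → Bool
odd? zero    = false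
odd? (suc n) = not (odd? n)

odd?-double : ∀ s → odd? (s + s) ≡ false
odd?-double zero    = refl
odd?-double (suc s) = trans (cong (λ z → not (odd? z)) (+-suc s s)) (cong (λ b → not (not b)) (odd?-double s))

xor-fold-parity : ∀ {A : Set} (p : A → Bool) xs →
  foldr _xor_ false (map p xs) ≡ odd? (sum (map (λ x → ind (p x)) xs))
xor-fold-parity p []       = refl
xor-fold-parity p (x ∷ xs) with p x
... | true  = cong not (xor-fold-parity p xs)
... | false = xor-fold-parity p xs

𝟏 : ∀ {n} → V n
𝟏 = replicate _ true

⪯-𝟏 : ∀ {n} (x : V n) → (x ⪯ 𝟏) ≡ true
⪯-𝟏 []          = refl
⪯-𝟏 (false ∷ x) = ⪯-𝟏 x
⪯-𝟏 (true ∷ x)  = ⪯-𝟏 x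

wt-𝟏 : ∀ n → wt (𝟏 {n}) ≡ n
wt-𝟏 zero    = refl
wt-𝟏 (suc n) = cong suc (wt-𝟏 n)

wt≤n : ∀ {n} (u : V n) → wt u ≤ n
wt≤n []          = z≤n
wt≤n (false ∷ u) = m≤n⇒m≤1+n (wt≤n u)
wt≤n (true ∷ u)  = s≤s (wt≤n u)

max-lub : ∀ {A : Set} (f : A → ℕ) k xs → (∀ x → f x ≤ k) → foldr _⊔_ 0 (map f xs) ≤ k
max-lub f k []       _   = z≤n
max-lub f k (x ∷ xs) f≤k = ⊔-lub (f≤k x) (max-lub f k xs f≤k)

max-upper : ∀ {A : Set} (f : A → ℕ) xs x → x ∈ xs → f x ≤ foldr _⊔_ 0 (map f xs)
max-upper f (y ∷ xs) x (here refl) = m≤m⊔n (f x) _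
max-upper f (y ∷ xs) x (there x∈xs) = m≤n⇒m≤o⊔n (f y) (max-upper f xs x x∈xs)

top-coefficient : ∀ n (f : V n → Bool) → anfCoeff f 𝟏 ≡ odd? (weight f)
top-coefficient n f = trans
  (cong (foldr _xor_ false) (map-cong (λ x → cong (_∧ f x) (⪯-𝟏 x)) (allVecs n)))
  (xor-fold-parity f (allVecs n))

odd-weight⇒full-degree : ∀ n (f : V n → Bool) s → weight f ≡ suc (s + s) → deg f ≡ n
odd-weight⇒full-degree n f s odd = ≤-antisym (max-lub term n (allVecs n) term≤n)
  (subst (_≤ deg f) top-term (max-upper term (allVecs n) 𝟏 (allVecs-complete 𝟏)))
  where
  term : V n → ℕ
  term u = if anfCoeff f u then wt u else 0
  term≤n : ∀ u → term u ≤ n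
  term≤n u with anfCoeff f u
  ... | true  = wt≤n u
  ... | false = z≤n
  top≡1 : anfCoeff f 𝟏 ≡ true
  top≡1 = trans (top-coefficient n f) (trans (cong odd? odd) (cong not (odd?-double s)))
  top-term : term 𝟏 ≡ n
  top-term rewrite top≡1 = wt-𝟏 n

autocorr : ∀ {n} → (V n → Bool) → V n → ℕ
autocorr g d = count (λ x → g x ≐ g (x ⊕ d))

-- Summing the autocorrelation over all d counts the pairs (x, z) with g x = g z,
-- i.e. B² + A² where B = #{g = 1} and A = #{g = 0}.
autocorrelation-sum : ∀ n (g : V n → Bool) →
  ∑ n (autocorr g) ≡ count g * count g + count (λ x → not (g x)) * count (λ x → not (g x))
autocorrelation-sum n g = begin
  ∑ n (λ d → ∑ n (λ x → ind (g x ≐ g (x ⊕ d))))   ≡⟨ ∑-swap n n _ ⟩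
  ∑ n (λ x → ∑ n (λ d → ind (g x ≐ g (x ⊕ d))))   ≡⟨ ∑-cong n translate ⟩
  ∑ n (λ x → ∑ n (λ z → ind (g x ≐ g z)))         ≡⟨ ∑-cong n row ⟩
  ∑ n (λ x → ind (g x) * B + ind (not (g x)) * A) ≡⟨ ∑-+ n _ _ ⟩
  ∑ n (λ x → ind (g x) * B) + ∑ n (λ x → ind (not (g x)) * A)
    ≡⟨ cong₂ _+_ (trans (∑-cong n (λ x → *-comm (ind (g x)) B)) (∑-*ˡ n B _))
                 (trans (∑-cong n (λ x → *-comm (ind (not (g x))) A)) (∑-*ˡ n A _)) ⟩
  B * B + A * A ∎
  where
  B = count g
  A = count (λ x → not (g x))
  translate : ∀ x → ∑ n (λ d → ind (g x ≐ g (x ⊕ d))) ≡ ∑ n (λ z → ind (g x ≐ g z))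
  translate x = trans (∑-cong n (λ d → cong (λ z → ind (g x ≐ g z)) (⊕-comm x d)))
                      (∑-translate n x (λ z → ind (g x ≐ g z)))
  row : ∀ x → ∑ n (λ z → ind (g x ≐ g z)) ≡ ind (g x) * B + ind (not (g x)) * A
  row x with g x
  ... | true  = trans (∑-cong n (λ z → cong ind (not-involutive (g z)))) (sym (trans (+-identityʳ _) (+-identityʳ _)))
  ... | false = sym (+-identityʳ _)

module PhiPair (m : ℕ) (F : V (suc (suc m)) → V (suc (suc m)))
  (Φ : V (suc (suc m)) → V (suc (suc m))) (φ : V (suc (suc m)) → Bool)
  (apn : APN F) (pair : IsPhiPair F Φ φ) where

  n : ℕ
  n = suc (suc m)

  D : V n → V n → V n
  D a x = F x ⊕ F (x ⊕ a)

  Φ≢𝟎 : ∀ a → a ≢ 𝟎 → Φ a ≢ 𝟎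
  Φ≢𝟎 a a≢𝟎 = proj₁ (proj₂ (proj₂ pair) a a≢𝟎)

  image⊆B : ∀ a → a ≢ 𝟎 → ∀ x → Φ a · D a x ≡ φ a
  image⊆B a a≢𝟎 x = proj₁ (proj₂ (proj₂ (proj₂ pair) a a≢𝟎) (D a x)) (x , refl)

  B⊆image : ∀ a → a ≢ 𝟎 → ∀ y → Φ a · y ≡ φ a → Σ (V n) (λ x → D a x ≡ y)
  B⊆image a a≢𝟎 y = proj₂ (proj₂ (proj₂ (proj₂ pair) a a≢𝟎) y)

  D-⊕ : ∀ a b x → D (a ⊕ b) x ≡ D a x ⊕ D b (x ⊕ a)
  D-⊕ a b x = begin
    F x ⊕ F (x ⊕ (a ⊕ b))                       ≡⟨ cong (λ z → F x ⊕ F z) (sym (⊕-assoc x a b)) ⟩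
    F x ⊕ F ((x ⊕ a) ⊕ b)                       ≡⟨ cong (F x ⊕_) (sym (⊕-cancelˡ (F (x ⊕ a)) _)) ⟩
    F x ⊕ (F (x ⊕ a) ⊕ (F (x ⊕ a) ⊕ F ((x ⊕ a) ⊕ b))) ≡⟨ sym (⊕-assoc (F x) _ _) ⟩
    (F x ⊕ F (x ⊕ a)) ⊕ (F (x ⊕ a) ⊕ F ((x ⊕ a) ⊕ b)) ∎

  -- By the chain rule the image of
  -- D (a ⊕ b) lies in the hyperplane Φ a · y = φ a ⊕ φ b, and a hyperplane
  -- determines its normal.
  fibre-linear : ∀ a b → a ≢ 𝟎 → b ≢ 𝟎 → a ≢ b → Φ b ≡ Φ a →
    (Φ (a ⊕ b) ≡ Φ a) × (φ (a ⊕ b) ≡ φ a xor φ b)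
  fibre-linear a b a≢𝟎 b≢𝟎 a≢b Φb≡Φa = Φ-eq , φ-eq
    where
    a⊕b≢𝟎 : a ⊕ b ≢ 𝟎
    a⊕b≢𝟎 z = a≢b (⊕-≡𝟎 a b z)
    image : ∀ x → Φ a · D (a ⊕ b) x ≡ φ a xor φ b
    image x = begin
      Φ a · D (a ⊕ b) x                       ≡⟨ cong (Φ a ·_) (D-⊕ a b x) ⟩
      Φ a · (D a x ⊕ D b (x ⊕ a))             ≡⟨ dot-⊕ʳ (Φ a) _ _ ⟩
      (Φ a · D a x) xor (Φ a · D b (x ⊕ a))   ≡⟨ cong₂ _xor_ (image⊆B a a≢𝟎 x)
                                                   (trans (cong (_· D b (x ⊕ a)) (sym Φb≡Φa)) (image⊆B b b≢𝟎 (x ⊕ a))) ⟩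
      φ a xor φ b                             ∎
    Φ-eq : Φ (a ⊕ b) ≡ Φ a
    Φ-eq = hyperplane-normal m (Φ (a ⊕ b)) (Φ a) (φ (a ⊕ b)) (φ a xor φ b) (Φ≢𝟎 _ a⊕b≢𝟎) (Φ≢𝟎 a a≢𝟎)
      (λ y on-B → let (x , Dx≡y) = B⊆image (a ⊕ b) a⊕b≢𝟎 y on-B in trans (cong (Φ a ·_) (sym Dx≡y)) (image x))
    φ-eq : φ (a ⊕ b) ≡ φ a xor φ b
    φ-eq = trans (sym (image⊆B (a ⊕ b) a⊕b≢𝟎 𝟎)) (trans (cong (_· D (a ⊕ b) 𝟎) Φ-eq) (image 𝟎))

  -- APN: for d ≠ 0 the derivative D d is exactly 2-to-1 onto B_d (x and x ⊕ d
  -- always share their value).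
  preimages : ∀ d → d ≢ 𝟎 → ∀ y → count (λ x → D d x == y) ≡ 2 * ind (Φ d · y ≐ φ d)
  preimages d d≢𝟎 y with (Φ d · y) ≟ᵇ φ d
  ... | yes on-B = trans (≤-antisym (apn d d≢𝟎 y) (two-witnesses _ x₀ (x₀ ⊕ d) (==-complete Dx₀≡y) (==-complete Dx₁≡y) x₀≢x₁))
                         (cong (λ b → 2 * ind b) (sym (≐-complete on-B)))
    where
    x₀ = proj₁ (B⊆image d d≢𝟎 y on-B)
    Dx₀≡y = proj₂ (B⊆image d d≢𝟎 y on-B)
    Dx₁≡y : D d (x₀ ⊕ d) ≡ y
    Dx₁≡y = trans (trans (cong (F (x₀ ⊕ d) ⊕_) (cong F (⊕-cancelʳ x₀ d))) (⊕-comm (F (x₀ ⊕ d)) (F x₀))) Dx₀≡y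
    x₀≢x₁ : x₀ ≢ x₀ ⊕ d
    x₀≢x₁ e = d≢𝟎 (⊕-fix x₀ d (sym e))
  ... | no off-B = trans (∑-cong n empty) (trans (sum-map-0 (allVecs n)) (cong (λ b → 2 * ind b) (sym (≐-≢ off-B))))
    where
    empty : ∀ x → ind (D d x == y) ≡ 0
    empty x with D d x == y in e
    ... | false = refl
    ... | true  = ⊥-elim (off-B (trans (cong (Φ d ·_) (sym (==-sound _ _ e))) (image⊆B d d≢𝟎 x)))

  -- For d ≠ 0 and a nonzero v ≠ Φ d, the functional v · D d is balanced:
  -- D d covers B_d twice, and B_d meets each hyperplane v · y = e in 2^m points.
  derivative-balanced : ∀ d → d ≢ 𝟎 → ∀ v → v ≢ 𝟎 → Φ d ≢ v → ∀ e →
    count (λ x → v · D d x ≐ e) ≡ 2 * 2 ^ m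
  derivative-balanced d d≢𝟎 v v≢𝟎 Φd≢v e = begin
    count (λ x → v · D d x ≐ e)
      ≡⟨ ∑-fibres n n (D d) (λ y → ind (v · y ≐ e)) ⟩
    ∑ n (λ y → ind (v · y ≐ e) * count (λ x → D d x == y))
      ≡⟨ ∑-cong n (λ y → cong (ind (v · y ≐ e) *_) (preimages d d≢𝟎 y)) ⟩
    ∑ n (λ y → ind (v · y ≐ e) * (2 * ind (Φ d · y ≐ φ d)))
      ≡⟨ ∑-cong n (λ y → both (v · y ≐ e) (Φ d · y ≐ φ d)) ⟩
    ∑ n (λ y → 2 * ind ((Φ d · y ≐ φ d) ∧ (v · y ≐ e)))
      ≡⟨ ∑-*ˡ n 2 _ ⟩
    2 * meet (Φ d) v (φ d) e
      ≡⟨ cong (2 *_) (meet-size m (Φ d) v (Φ≢𝟎 d d≢𝟎) v≢𝟎 Φd≢v (φ d) e) ⟩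
    2 * 2 ^ m ∎
    where
    both : ∀ p q → ind p * (2 * ind q) ≡ 2 * ind (q ∧ p)
    both false false = refl
    both false true  = refl
    both true  false = refl
    both true  true  = refl

  autocorr-twisted : ∀ v w d → autocorr (λ x → (v · F x) xor (w · x)) d ≡ count (λ x → v · D d x ≐ w · d)
  autocorr-twisted v w d = ∑-cong n (λ x → cong ind (begin
    ((v · F x) xor (w · x)) ≐ ((v · F (x ⊕ d)) xor (w · (x ⊕ d)))
      ≡⟨ cong (λ z → ((v · F x) xor (w · x)) ≐ ((v · F (x ⊕ d)) xor z)) (dot-⊕ʳ w x d) ⟩
    ((v · F x) xor (w · x)) ≐ ((v · F (x ⊕ d)) xor ((w · x) xor (w · d)))
      ≡⟨ cancel (v · F x) (w · x) (v · F (x ⊕ d)) (w · d) ⟩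
    ((v · F x) xor (v · F (x ⊕ d))) ≐ (w · d)
      ≡⟨ cong (_≐ (w · d)) (sym (dot-⊕ʳ v (F x) (F (x ⊕ d)))) ⟩
    v · D d x ≐ w · d ∎))
    where
    cancel : ∀ p q r s → (p xor q) ≐ (r xor (q xor s)) ≡ (p xor r) ≐ s
    cancel false false false false = refl
    cancel false false false true  = refl
    cancel false false true  false = refl
    cancel false false true  true  = refl
    cancel false true  false false = refl
    cancel false true  false true  = refl
    cancel false true  true  false = refl
    cancel false true  true  true  = refl
    cancel true  false false false = refl
    cancel true  false false true  = refl
    cancel true  false true  false = refl
    cancel true  false true  true  = refl
    cancel true  true  false false = refl
    cancel true  true  false true  = refl
    cancel true  true  true  false = refl
    cancel true  true  true  true  = refl

  -- Hypothesis: a ≠ 0 is the only nonzero vector in its Φ-fibre.  Then 2ⁿ⁺¹ is a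
  -- perfect square.  With v = Φ a, w · a = φ a and g x = v · F x ⊕ w · x, the
  -- autocorrelation of g is 2ⁿ at d ∈ {0, a} and X = 2ⁿ⁻¹ elsewhere
  -- (derivative-balanced, as Φ d ≠ v); summing over d and comparing with
  -- autocorrelation-sum gives A² + B² = 2(X² + X) with A + B = 2X.
  module Lonely (a : V n) (a≢𝟎 : a ≢ 𝟎) (lonely : ∀ b → b ≢ 𝟎 → Φ b ≡ Φ a → b ≡ a) where

    v = Φ a
    w = proj₁ (solve-dot a a≢𝟎 (φ a))
    g : V n → Bool
    g x = (v · F x) xor (w · x)
    X = 2 * 2 ^ m
    B = count g
    A = count (λ x → not (g x))

    A+B : A + B ≡ 2 * X
    A+B = trans (+-comm A B) (trans (sym (count-split (λ _ → true) g)) (count-true n _ (λ _ → refl)))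

    autocorr-values : ∀ d → autocorr g d ≡ X + (if d == 𝟎 then X else 0) + (if d == a then X else 0)
    autocorr-values d with d == 𝟎 in d≟𝟎 | d == a in d≟a
    ... | true  | true  = ⊥-elim (a≢𝟎 (trans (sym (==-sound d a d≟a)) (==-sound d 𝟎 d≟𝟎)))
    ... | true  | false = trans (count-true n _ always) (double X)
      where
      always : ∀ x → (g x ≐ g (x ⊕ d)) ≡ true
      always x = ≐-complete (cong g (sym (trans (cong (x ⊕_) (==-sound d 𝟎 d≟𝟎)) (⊕-identityʳ x))))
      double : ∀ X → 2 * X ≡ X + X + 0
      double = solve-∀
    ... | false | true  = trans (autocorr-twisted v w d) (trans (count-true n _ always) (double X))
      where
      d≡a = ==-sound d a d≟a
      always : ∀ x → (v · D d x ≐ w · d) ≡ true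
      always x = ≐-complete (begin
        v · D d x ≡⟨ cong (λ z → v · D z x) d≡a ⟩
        v · D a x ≡⟨ image⊆B a a≢𝟎 x ⟩
        φ a       ≡⟨ sym (proj₂ (solve-dot a a≢𝟎 (φ a))) ⟩
        w · a     ≡⟨ cong (w ·_) (sym d≡a) ⟩
        w · d     ∎)
      double : ∀ X → 2 * X ≡ X + 0 + X
      double = solve-∀
    ... | false | false = trans (autocorr-twisted v w d)
        (trans (derivative-balanced d d≢𝟎 v (Φ≢𝟎 a a≢𝟎) Φd≢v (w · d)) (sym (trans (+-identityʳ _) (+-identityʳ X))))
      where
      d≢𝟎 : d ≢ 𝟎
      d≢𝟎 = ==-false⇒≢ d≟𝟎
      Φd≢v : Φ d ≢ v
      Φd≢v Φd≡Φa = ==-false⇒≢ d≟a (lonely d d≢𝟎 Φd≡Φa)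

    autocorr-total : ∑ n (autocorr g) ≡ 2 ^ n * X + X + X
    autocorr-total = begin
      ∑ n (autocorr g)
        ≡⟨ ∑-cong n autocorr-values ⟩
      ∑ n (λ d → X + (if d == 𝟎 then X else 0) + (if d == a then X else 0))
        ≡⟨ ∑-+ n _ _ ⟩
      ∑ n (λ d → X + (if d == 𝟎 then X else 0)) + ∑ n (λ d → if d == a then X else 0)
        ≡⟨ cong₂ _+_ (∑-+ n _ _) (∑-δ n a (λ _ → X)) ⟩
      ∑ n (λ _ → X) + ∑ n (λ d → if d == 𝟎 then X else 0) + X
        ≡⟨ cong (_+ X) (cong₂ _+_ (∑-const n X) (∑-δ n 𝟎 (λ _ → X))) ⟩
      2 ^ n * X + X + X ∎

    A²+B² : A * A + B * B ≡ 2 * (X * X + X)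
    A²+B² = trans (+-comm (A * A) (B * B)) (trans (sym (autocorrelation-sum n g)) (trans autocorr-total (regroup X)))
      where
      regroup : ∀ X → 2 * X * X + X + X ≡ 2 * (X * X + X)
      regroup = solve-∀

    square : Σ ℕ (λ t → t * t ≡ 4 * X)
    square = square-gap A B X A+B A²+B²

  Partner : V n → V n → Set
  Partner a b = b ≢ 𝟎 × b ≢ a × Φ b ≡ Φ a

  partner : (∀ t → t * t ≢ 4 * (2 * 2 ^ m)) → ∀ a → a ≢ 𝟎 → Σ (V n) (Partner a)
  partner no-root a a≢𝟎 with search (λ b → ¬? (b ≟ᵥ 𝟎) ×-dec (¬? (b ≟ᵥ a) ×-dec (Φ b ≟ᵥ Φ a)))
  ... | inj₁ found = found
  ... | inj₂ none  = ⊥-elim (no-root t t²≡)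
    where
    lonely : ∀ b → b ≢ 𝟎 → Φ b ≡ Φ a → b ≡ a
    lonely b b≢𝟎 Φb≡Φa with b ≟ᵥ a
    ... | yes b≡a = b≡a
    ... | no  b≢a = ⊥-elim (none b (b≢𝟎 , b≢a , Φb≡Φa))
    t   = proj₁ (Lonely.square a a≢𝟎 lonely)
    t²≡ = proj₂ (Lonely.square a a≢𝟎 lonely)

  support : V n → Bool
  support a = not (a == 𝟎) ∧ φ a

  support-intro : ∀ a → a ≢ 𝟎 → φ a ≡ true → support a ≡ true
  support-intro a a≢𝟎 φa rewrite ==-false a 𝟎 a≢𝟎 = φa

  support-elim : ∀ a → support a ≡ true → a ≢ 𝟎 × φ a ≡ true
  support-elim a s = (λ a≡𝟎 → true≢false (trans (sym s) (cong (λ t → not t ∧ φ a) (==-complete a≡𝟎))))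
                   , ∧-conicalʳ _ _ s

  FibreZero : V n → V n → Set
  FibreZero u c = c ≢ 𝟎 × Φ c ≡ u × φ c ≡ false

  -- Given partners, the fibre of every a ≠ 0 with φ a = 1 contains a zero of φ: the
  -- partner b itself, or a ⊕ b when φ b = 1 (then φ (a ⊕ b) = 1 ⊕ 1 = 0).
  zero-in-fibre : (∀ a → a ≢ 𝟎 → Σ (V n) (Partner a)) → ∀ a → a ≢ 𝟎 → φ a ≡ true → Σ (V n) (FibreZero (Φ a))
  zero-in-fibre partners a a≢𝟎 φa with partners a a≢𝟎
  ... | b , b≢𝟎 , b≢a , Φb≡Φa with φ b in φb
  ...   | false = b , b≢𝟎 , Φb≡Φa , φb
  ...   | true  = a ⊕ b , (λ z → b≢a (sym (⊕-≡𝟎 a b z))) , proj₁ linear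
                 , trans (proj₂ linear) (cong₂ _xor_ φa φb)
    where linear = fibre-linear a b a≢𝟎 b≢𝟎 (λ a≡b → b≢a (sym a≡b)) Φb≡Φa

  module Pairing (partners : ∀ a → a ≢ 𝟎 → Σ (V n) (Partner a)) where

    κ : V n → V n
    κ u = pick (λ c → ¬? (c ≟ᵥ 𝟎) ×-dec ((Φ c ≟ᵥ u) ×-dec (φ c ≟ᵇ false)))

    κ-zero : ∀ a → support a ≡ true → FibreZero (Φ a) (κ (Φ a))
    κ-zero a s = pick-sound _ (zero-in-fibre partners a (proj₁ (support-elim a s)) (proj₂ (support-elim a s)))

    ι : V n → V n
    ι a = if support a then a ⊕ κ (Φ a) else a

    ι-step : ∀ a → support a ≡ true → support (a ⊕ κ (Φ a)) ≡ true × Φ (a ⊕ κ (Φ a)) ≡ Φ a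
    ι-step a s = support-intro (a ⊕ c) a⊕c≢𝟎 φ-sum , proj₁ linear
      where
      c = κ (Φ a)
      a≢𝟎 = proj₁ (support-elim a s)
      φa  = proj₂ (support-elim a s)
      c≢𝟎 = proj₁ (κ-zero a s)
      Φc≡Φa = proj₁ (proj₂ (κ-zero a s))
      φc  = proj₂ (proj₂ (κ-zero a s))
      a≢c : a ≢ c
      a≢c a≡c = true≢false (trans (sym φa) (trans (cong φ a≡c) φc))
      linear = fibre-linear a c a≢𝟎 c≢𝟎 a≢c Φc≡Φa
      a⊕c≢𝟎 : a ⊕ c ≢ 𝟎
      a⊕c≢𝟎 z = a≢c (⊕-≡𝟎 a c z)
      φ-sum : φ (a ⊕ c) ≡ true
      φ-sum = trans (proj₂ linear) (cong₂ _xor_ φa φc)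

    ι-on : ∀ a → support a ≡ true → ι a ≡ a ⊕ κ (Φ a)
    ι-on a s rewrite s = refl

    ι-off : ∀ a → support a ≡ false → ι a ≡ a
    ι-off a s rewrite s = refl

    ι-support : ∀ a → support (ι a) ≡ support a
    ι-support a = by-cases (support a) refl
      where
      by-cases : ∀ t → support a ≡ t → support (ι a) ≡ support a
      by-cases true  s = trans (cong support (ι-on a s)) (trans (proj₁ (ι-step a s)) (sym s))
      by-cases false s = cong support (ι-off a s)

    ι-involutive : ∀ a → ι (ι a) ≡ a
    ι-involutive a = by-cases (support a) refl
      where
      by-cases : ∀ t → support a ≡ t → ι (ι a) ≡ a
      by-cases false s = trans (cong ι (ι-off a s)) (ι-off a s)
      by-cases true  s = begin
        ι (ι a)                               ≡⟨ cong ι (ι-on a s) ⟩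
        ι (a ⊕ κ (Φ a))                       ≡⟨ ι-on _ (proj₁ (ι-step a s)) ⟩
        (a ⊕ κ (Φ a)) ⊕ κ (Φ (a ⊕ κ (Φ a)))   ≡⟨ cong (λ u → (a ⊕ κ (Φ a)) ⊕ κ u) (proj₂ (ι-step a s)) ⟩
        (a ⊕ κ (Φ a)) ⊕ κ (Φ a)               ≡⟨ ⊕-cancelʳ a _ ⟩
        a                                     ∎

    ι-no-fix : ∀ a → support a ≡ true → ι a ≢ a
    ι-no-fix a s fix = proj₁ (κ-zero a s) (⊕-fix a _ (trans (sym (ι-on a s)) fix))

    -- weight φ = #support + [φ 0 = 1] is even + 1.
    weight-odd : Σ ℕ (λ s → weight φ ≡ suc (s + s))
    weight-odd = s , (begin
      count φ                                                   ≡⟨ ∑-cong n split ⟩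
      ∑ n (λ a → ind (support a) + (if a == 𝟎 then 1 else 0))  ≡⟨ ∑-+ n _ _ ⟩
      count support + ∑ n (λ a → if a == 𝟎 then 1 else 0)      ≡⟨ cong₂ _+_ (proj₂ even) (∑-δ n 𝟎 (λ _ → 1)) ⟩
      s + s + 1                                                 ≡⟨ +-comm (s + s) 1 ⟩
      suc (s + s)                                               ∎)
      where
      even = involution-even n support ι ι-involutive ι-support ι-no-fix
      s = proj₁ even
      split : ∀ a → ind (φ a) ≡ ind (support a) + (if a == 𝟎 then 1 else 0)
      split a with a == 𝟎 in a≟𝟎
      ... | true  = cong ind (trans (cong φ (==-sound a 𝟎 a≟𝟎)) (proj₁ (proj₂ pair)))
      ... | false = sym (+-identityʳ _)


-- In even dimension n = 2j + 2 the weight of φ is odd: 2ⁿ⁺¹ = 2·4^(j+1) is not a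
-- square, so every nonzero vector has a partner in its Φ-fibre.
weight-odd-in-dim-2j+2 : ∀ j (F : V (suc (suc (j + j))) → V (suc (suc (j + j)))) →
  (Φ : V (suc (suc (j + j))) → V (suc (suc (j + j)))) (φ : V (suc (suc (j + j))) → Bool) →
  APN F → IsPhiPair F Φ φ → Σ ℕ (λ s → weight φ ≡ suc (s + s))
weight-odd-in-dim-2j+2 j F Φ φ apn pair = Pairing.weight-odd (partner no-root)
  where
  open PhiPair (j + j) F Φ φ apn pair
  no-root : ∀ t → t * t ≢ 4 * (2 * 2 ^ (j + j))
  no-root t e = not-square (suc j) t (trans e (sym (four-times j)))

-- The same for every even n; for n = 0 the only point is 0 and φ 0 = 1, and
-- n = r + 2 = 2(j + 1) gives r = j + j.
weight-odd-in-even-dim : ∀ n → 2 ∣ n → (F : V n → V n) → APN F →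
  (Φ : V n → V n) (φ : V n → Bool) → IsPhiPair F Φ φ → Σ ℕ (λ s → weight φ ≡ suc (s + s))
weight-odd-in-even-dim zero _ F apn Φ φ pair = 0 , cong (λ b → ind b + 0) (proj₁ (proj₂ pair))
weight-odd-in-even-dim (suc zero) 2∣1 F apn Φ φ pair with ∣1⇒≡1 2∣1
... | ()
weight-odd-in-even-dim (suc (suc r)) (divides zero ()) F apn Φ φ pair
weight-odd-in-even-dim (suc (suc r)) (divides (suc j) e) F apn Φ φ pair
  with trans (suc-injective (suc-injective e)) (trans (*-comm j 2) (cong (j +_) (+-identityʳ j)))
... | refl = weight-odd-in-dim-2j+2 j F Φ φ apn pair

odd⇒¬2∣ : ∀ {k} s → k ≡ suc (s + s) → ¬ (2 ∣ k)
odd⇒¬2∣ s odd (divides q e) =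
  odd≢even s q (trans (sym odd) (trans e (trans (*-comm q 2) (cong (q +_) (+-identityʳ q)))))

proposition1 : (n : ℕ) → 2 ∣ n → (F : V n → V n) → Quadratic F → APN F →
    (Φ : V n → V n) (φ : V n → Bool) → IsPhiPair F Φ φ →
      (deg φ ≡ n) × ¬ (2 ∣ weight φ)
proposition1 n 2∣n F _ apn Φ φ pair = odd-weight⇒full-degree n φ s odd , odd⇒¬2∣ s odd
  where
  s   = proj₁ (weight-odd-in-even-dim n 2∣n F apn Φ φ pair)
  odd = proj₂ (weight-odd-in-even-dim n 2∣n F apn Φ φ pair)
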